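{- For every $n\ge1$ there is a bijection $\theta:\mathcal O_{n+1}\to\mathcal H_n$ such that for every $T\in\mathcal O_{n+1}$, $${\rm young}_T(1)={\rm tree}(\theta(T)),\qquad {\rm eld}(T)={\rm bdeg}(\theta(T)),\qquad {\rm imp}(T)={\rm imp}(\theta(T)).$$
   Context: Plane trees: a plane tree on a finite totally ordered set is a rooted tree whose children of each vertex are linearly ordered (left to right). A vertex $j$ is a descendant of $i$ if the path from the root to $j$ passes through $i$ (each vertex is its own descendant); $\beta_T(i)$ is the smallest descendant of $i$. A child $j$ of $v$ is elder if $v$ has a child $k$ to the right of $j$ with $\beta_T(k)<\beta_T(j)$, and younger otherwise; ${\rm young}_T(v)$ is the number of younger children of $v$; ${\rm eld}(T)$ is the total number of elder vertices. An edge $(i,j)$ ($j$ a child of $i$) is proper if $j$ is an elder child of $i$ or $i<\beta_T(j)$, improper otherwise; ${\rm imp}(T)$ is the number of improper edges. $\mathcal O_{n+1}$ is the set of plane trees on $\{1,\dots,n+1\}$ with root $1$. Half-mobile trees: a half-mobile tree is a rooted tree with two kinds of vertices, labeled (white) and unlabeled (black), such that each black vertex has at least two children, all of them white; there is a fixed cyclic order on the children of each black vertex; the children of each white vertex are unordered. A forest of half-mobile trees on $[n]$ is a graph whose connected components are half-mobile trees and whose white vertices are labeled bijectively by $[n]=\{1,\dots,n\}$ (forests are considered up to isomorphism preserving labels, roots and cyclic orders). For any vertex $v$, $\beta(v)$ is the smallest white descendant of $v$ (including $v$ if white). The cyclic order on the children of a black vertex is represented linearly by declaring its rightmost child to be the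 child $x$ with the smallest $\beta(x)$. An edge $(u,v)$ ($v$ a child of $u$) is improper if either $u,v$ are both white and $u>\beta(v)$, or $u$ is black, $v$ is its rightmost child, and the (white) father of $u$ exists and is greater than $\beta(v)$. For a forest $F$: ${\rm imp}(F)$ is its number of improper edges, ${\rm tree}(F)$ its number of half-mobile trees, and ${\rm bdeg}(F)=\sum_{v\ \text{black}}({\rm deg}_F(v)-1)$, where ${\rm deg}_F(v)$ is the number of children of $v$. $\mathcal H_n$ is the set of forests of half-mobile trees on $[n]$. -}

module Defs where

open import Data.Nat using (ℕ; zero; suc; _+_; _∸_; _⊓_; _<_; _≤_; _<ᵇ_; _≤ᵇ_)
open import Data.Bool using (Bool; true; false; if_then_else_; not; _∧_)
open import Data.List using (List; []; _∷_; _++_; map; upTo; length)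
open import Data.Bool.ListAction using (any)
open import Data.List.Relation.Unary.All using (All)
open import Data.List.Relation.Unary.Linked using (Linked)
open import Data.List.Relation.Binary.Permutation.Propositional using (_↭_)
open import Data.Maybe using (Maybe; just; nothing)
open import Data.Product using (Σ; _×_; ∃)
open import Data.Unit using (⊤)
open import Data.Empty using (⊥)
open import Relation.Binary.PropositionalEquality using (_≡_)

range1 : ℕ → List ℕ
range1 m = map suc (upTo m)

data PTree : Set where
  node : ℕ → List PTree → PTree

rootLabel : PTree → ℕ
rootLabel (node i _) = i

mutual
  labels : PTree → List ℕ
  labels (node i cs) = i ∷ labelsCh cs

  labelsCh : List PTree → List ℕ
  labelsCh []       = []
  labelsCh (c ∷ cs) = labels c ++ labelsCh cs

mutual
  β : PTree → ℕ
  β (node i cs) = βFrom i cs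

  βFrom : ℕ → List PTree → ℕ
  βFrom m []       = m
  βFrom m (c ∷ cs) = βFrom (m ⊓ β c) cs

elderB : PTree → List PTree → Bool
elderB c rs = any (λ k → β k <ᵇ β c) rs

ind : Bool → ℕ
ind true  = 1
ind false = 0

youngCh : List PTree → ℕ
youngCh []       = 0
youngCh (c ∷ cs) = ind (not (elderB c cs)) + youngCh cs

youngRoot : PTree → ℕ
youngRoot (node _ cs) = youngCh cs

mutual
  eld : PTree → ℕ
  eld (node _ cs) = eldCh cs

  eldCh : List PTree → ℕ
  eldCh []       = 0
  eldCh (c ∷ cs) = ind (elderB c cs) + eld c + eldCh cs

mutual
  imp : PTree → ℕ
  imp (node i cs) = impCh i cs

  impCh : ℕ → List PTree → ℕ
  impCh i []       = 0
  impCh i (c ∷ cs) = ind (not (elderB c cs) ∧ not (i <ᵇ β c)) + imp c + impCh i cs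

IsO : ℕ → PTree → Set
IsO n T = rootLabel T ≡ 1 × labels T ↭ range1 (suc n)

data HTree : Set where
  white : ℕ → List HTree → HTree
  black : List HTree → HTree

Forest : Set
Forest = List HTree

mutual
  βH : HTree → ℕ
  βH (white i cs)     = βHFrom i cs
  βH (black [])       = 0          -- never used for valid trees
  βH (black (c ∷ cs)) = βHFrom (βH c) cs

  βHFrom : ℕ → List HTree → ℕ
  βHFrom m []       = m
  βHFrom m (c ∷ cs) = βHFrom (m ⊓ βH c) cs

mutual
  whiteLabels : HTree → List ℕ
  whiteLabels (white i cs) = i ∷ whiteLabelsCh cs
  whiteLabels (black cs)   = whiteLabelsCh cs

  whiteLabelsCh : List HTree → List ℕ
  whiteLabelsCh []       = []
  whiteLabelsCh (c ∷ cs) = whiteLabels c ++ whiteLabelsCh cs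

IsWhite : HTree → Set
IsWhite (white _ _) = ⊤
IsWhite (black _)   = ⊥

-- the list of children ends with the child of smallest β
-- (linear representation of the cyclic order: rightmost = smallest β)
LastIsMin : List HTree → Set
LastIsMin cs = ∃ λ xs → ∃ λ r → (cs ≡ xs ++ r ∷ []) × All (λ k → βH r < βH k) xs

mutual
  -- well-formed canonical half-mobile tree:
  --  * black vertices have ≥ 2 children, all white, listed with the
  --    smallest-β child last (cyclic order stored linearly);
  --  * children of white vertices are unordered; canonically listed by increasing β.
  WF : HTree → Set
  WF (white _ cs) = Linked _<_ (map βH cs) × WFs cs
  WF (black cs)   = 2 ≤ length cs × All IsWhite cs × LastIsMin cs × WFs cs

  WFs : List HTree → Set
  WFs []       = ⊤
  WFs (c ∷ cs) = WF c × WFs cs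

-- F ∈ H_n (canonical representative): trees listed by increasing β,
-- each well-formed, white labels exactly {1,…,n} (each once)
IsH : ℕ → Forest → Set
IsH n F = Linked _<_ (map βH F) × WFs F × whiteLabelsCh F ↭ range1 n

-- improper edges.  The Maybe ℕ argument is the label of the (white) father, if any.
mutual
  impT : Maybe ℕ → HTree → ℕ
  impT _  (white i cs) = impW i cs
  impT mf (black cs)   = impB mf cs

  impW : ℕ → List HTree → ℕ
  impW i []                 = 0
  impW i (white j ds ∷ cs)  = ind (βH (white j ds) <ᵇ i) + impT (just i) (white j ds) + impW i cs
  impW i (black ds ∷ cs)    = impT (just i) (black ds) + impW i cs

  -- edges from a black vertex whose father is mf; the rightmost (last) child
  -- gives an improper edge iff the father exists and is greater than its β
  impB : Maybe ℕ → List HTree → ℕ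
  impB mf []       = 0
  impB mf (c ∷ cs) = lastEdge mf c cs + impT nothing c + impB mf cs

  lastEdge : Maybe ℕ → HTree → List HTree → ℕ
  lastEdge (just f) c []      = ind (βH c <ᵇ f)
  lastEdge (just f) c (_ ∷ _) = 0
  lastEdge nothing  c _       = 0

impF : Forest → ℕ
impF []       = 0
impF (t ∷ ts) = impT nothing t + impF ts

treeF : Forest → ℕ
treeF = length

mutual
  bdegT : HTree → ℕ
  bdegT (white _ cs) = bdegCh cs
  bdegT (black cs)   = (length cs ∸ 1) + bdegCh cs

  bdegCh : List HTree → ℕ
  bdegCh []       = 0
  bdegCh (c ∷ cs) = bdegT c + bdegCh cs

{-# OPTIONS --safe #-}
module Submission where

-- θ keeps every non-root vertex i of T as the white vertex i − 1 and regroups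
-- the children of each vertex into blocks: a maximal run of elder siblings
-- together with the younger sibling closing it on the right (which has the
-- least β of the run) becomes a black vertex whose rightmost child is that
-- younger sibling, while a younger sibling with no elder run stays a direct
-- child of its white parent.  Hence the younger children of the root become
-- the trees of θ T, every elder vertex adds one to the degree of its black
-- vertex, and an edge to a younger child is improper exactly when the
-- corresponding white–white or father-to-rightmost edge of θ T is, while
-- edges to elder children are proper and become the other black edges.
-- Consecutive blocks come out ordered by β, so θ T is the canonical
-- representative, and flattening every black vertex into its children
-- inverts θ.

open import Defs
open import Data.Bool using (Bool; true; false; not; _∧_)
open import Data.Empty using (⊥; ⊥-elim)
open import Data.List using (List; []; _∷_; _++_; map; length; upTo)
open import Data.List.Properties using (++-assoc; ++-identityʳ; map-++; map-∘; map-id; map-upTo)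
open import Data.List.Relation.Binary.Permutation.Propositional using (_↭_; ↭-sym; ↭-prep; ↭⇒↭ₛ)
open import Data.List.Relation.Binary.Permutation.Propositional.Properties
  using (All-resp-↭; drop-∷) renaming (map⁺ to ↭-map⁺)
open import Data.List.Relation.Unary.All as All using (All; []; _∷_)
open import Data.List.Relation.Unary.All.Properties as All using (++⁻ˡ; ++⁻ʳ; ++⁺)
open import Data.List.Relation.Unary.Any using (Any; here; there)
import Data.List.Relation.Unary.Any.Properties as Any
open import Data.List.Relation.Unary.Linked as Linked using (Linked; []; [-]; _∷_)
open import Data.List.Relation.Unary.Linked.Properties using (Linked⇒All)
open import Data.List.Relation.Unary.Unique.Propositional using (Unique; []; _∷_)
import Data.List.Relation.Unary.Unique.Propositional.Properties as Unique
open import Data.Maybe using (nothing; just)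
open import Data.Nat using (ℕ; suc; pred; _+_; _⊓_; _<_; _≤_; _<ᵇ_; z≤n; s≤s; s<s⁻¹)
open import Data.Nat.Properties
open import Data.Product using (Σ; _×_; _,_; proj₁; ∃)
open import Data.Sum using ([_,_]′)
open import Data.Unit using (⊤; tt)
open import Function using (_∘_; _⇔_; mk⇔; Equivalence)
open import Relation.Binary.PropositionalEquality
open import Relation.Nullary.Reflects using (ofʸ; ofⁿ)
open import Algebra.Properties.CommutativeSemigroup +-commutativeSemigroup using (x∙yz≈y∙xz)
open import Data.List.Relation.Binary.Permutation.Setoid.Properties (setoid ℕ) using (Unique-resp-↭)

not-<ᵇ : ∀ {m n} → m ≢ n → not (m <ᵇ n) ≡ (n <ᵇ m)
not-<ᵇ {m} {n} m≢n with m <ᵇ n | <ᵇ-reflects-< m n | n <ᵇ m | <ᵇ-reflects-< n m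
... | true  | ofʸ m<n | true  | ofʸ n<m = ⊥-elim (<-asym m<n n<m)
... | true  | _       | false | _       = refl
... | false | _       | true  | _       = refl
... | false | ofⁿ m≮n | false | ofⁿ n≮m = ⊥-elim (m≢n (≤-antisym (≮⇒≥ n≮m) (≮⇒≥ m≮n)))

Linked-head : ∀ {x : ℕ} {xs} → Linked _<_ (x ∷ xs) → All (x <_) xs
Linked-head [-]        = []
Linked-head (x<y ∷ lk) = Linked⇒All <-trans x<y lk

Unique-++⁻ : ∀ {A : Set} (xs : List A) {ys} → Unique (xs ++ ys) →
             Unique xs × Unique ys × All (λ x → All (x ≢_) ys) xs
Unique-++⁻ []       u          = [] , u , []
Unique-++⁻ (x ∷ xs) (x∉ ∷ u) with Unique-++⁻ xs u
... | u-xs , u-ys , disjoint = ++⁻ˡ xs x∉ ∷ u-xs , u-ys , ++⁻ʳ xs x∉ ∷ disjoint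

-- Parametrised by the defining equations, so that it applies to both βFrom and βHFrom.
module RunningMin {A : Set} (f : A → ℕ) (minFrom : ℕ → List A → ℕ)
  (minFrom-[] : ∀ m → minFrom m [] ≡ m)
  (minFrom-∷ : ∀ m c cs → minFrom m (c ∷ cs) ≡ minFrom (m ⊓ f c) cs) where

  minFrom-⊓ : ∀ a b cs → minFrom (a ⊓ b) cs ≡ a ⊓ minFrom b cs
  minFrom-⊓ a b [] rewrite minFrom-[] (a ⊓ b) | minFrom-[] b = refl
  minFrom-⊓ a b (c ∷ cs) rewrite minFrom-∷ (a ⊓ b) c cs | minFrom-∷ b c cs | ⊓-assoc a b (f c) =
    minFrom-⊓ a (b ⊓ f c) cs

  minFrom-≤ : ∀ m cs → minFrom m cs ≤ m
  minFrom-≤ m [] rewrite minFrom-[] m = ≤-refl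
  minFrom-≤ m (c ∷ cs) rewrite minFrom-∷ m c cs = ≤-trans (minFrom-≤ (m ⊓ f c) cs) (m⊓n≤m m (f c))

  minFrom-≤-each : ∀ m cs → All (λ c → minFrom m cs ≤ f c) cs
  minFrom-≤-each m [] = []
  minFrom-≤-each m (c ∷ cs) rewrite minFrom-∷ m c cs =
    ≤-trans (minFrom-≤ (m ⊓ f c) cs) (m⊓n≤n m (f c)) ∷ minFrom-≤-each (m ⊓ f c) cs

  minFrom-< : ∀ {n} m cs → Any (λ c → f c < n) cs → minFrom m cs < n
  minFrom-< m cs = All.lookupWith ≤-<-trans (minFrom-≤-each m cs)

  minFrom-glb : ∀ {k} m cs → k ≤ m → All (λ c → k ≤ f c) cs → k ≤ minFrom m cs
  minFrom-glb m [] k≤m [] rewrite minFrom-[] m = k≤m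
  minFrom-glb m (c ∷ cs) k≤m (k≤c ∷ k≤cs) rewrite minFrom-∷ m c cs =
    minFrom-glb (m ⊓ f c) cs (⊓-glb k≤m k≤c) k≤cs

  minFrom-++ : ∀ m xs ys → minFrom m (xs ++ ys) ≡ minFrom (minFrom m xs) ys
  minFrom-++ m [] ys rewrite minFrom-[] m = refl
  minFrom-++ m (x ∷ xs) ys rewrite minFrom-∷ m x (xs ++ ys) | minFrom-∷ m x xs = minFrom-++ (m ⊓ f x) xs ys

  minFrom-All : ∀ (P : ℕ → Set) m cs → P m → All (P ∘ f) cs → P (minFrom m cs)
  minFrom-All P m [] Pm [] rewrite minFrom-[] m = Pm
  minFrom-All P m (c ∷ cs) Pm (Pc ∷ Pcs) rewrite minFrom-∷ m c cs =
    minFrom-All P (m ⊓ f c) cs Pm⊓c Pcs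
    where
    Pm⊓c : P (m ⊓ f c)
    Pm⊓c = [ (λ e → subst P (sym e) Pm) , (λ e → subst P (sym e) Pc) ]′ (⊓-sel m (f c))

open RunningMin β βFrom (λ _ → refl) (λ _ _ _ → refl) using () renaming
  ( minFrom-⊓ to βFrom-⊓; minFrom-≤ to βFrom-≤; minFrom-< to βFrom-<; minFrom-glb to βFrom-glb
  ; minFrom-++ to βFrom-++; minFrom-All to βFrom-All)
open RunningMin βH βHFrom (λ _ → refl) (λ _ _ _ → refl) using () renaming
  ( minFrom-⊓ to βHFrom-⊓; minFrom-≤ to βHFrom-≤; minFrom-≤-each to βHFrom-≤-each
  ; minFrom-glb to βHFrom-glb)

data ElderView (c : PTree) (ks : List PTree) : Bool → Set where
  elder   : Any (λ k → β k < β c) ks → ElderView c ks true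
  younger : All (λ k → β c ≤ β k) ks → ElderView c ks false

elderView : ∀ c ks → ElderView c ks (elderB c ks)
elderView c []       = younger []
elderView c (k ∷ ks) with β k <ᵇ β c | <ᵇ-reflects-< (β k) (β c)
... | true  | ofʸ k<c = elder (here k<c)
... | false | ofⁿ k≮c with elderB c ks | elderView c ks
...   | true  | elder ks<c   = elder (there ks<c)
...   | false | younger c≤ks = younger (≮⇒≥ k≮c ∷ c≤ks)

elderB-true : ∀ c ks → Any (λ k → β k < β c) ks → elderB c ks ≡ true
elderB-true c ks ks<c with elderB c ks | elderView c ks
... | true  | _            = refl
... | false | younger c≤ks = ⊥-elim (All.lookupWith (λ c≤k k<c → <⇒≱ k<c c≤k) c≤ks ks<c)

elderB-false : ∀ c ks → All (λ k → β c ≤ β k) ks → elderB c ks ≡ false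
elderB-false c ks c≤ks with elderB c ks | elderView c ks
... | true  | elder ks<c = ⊥-elim (All.lookupWith (λ c≤k k<c → <⇒≱ k<c c≤k) c≤ks ks<c)
... | false | _          = refl

mutual
  Admissible : PTree → Set
  Admissible (node i cs) = 1 ≤ i × All (λ c → i ≢ β c) cs × AdmissibleCh cs

  AdmissibleCh : List PTree → Set
  AdmissibleCh []       = ⊤
  AdmissibleCh (c ∷ cs) = Admissible c × All (λ k → β c ≢ β k) cs × AdmissibleCh cs

mutual
  β-All : ∀ {P : ℕ → Set} t → All P (labels t) → P (β t)
  β-All {P} (node i cs) (Pi ∷ Pcs) = βFrom-All P i cs Pi (β-AllCh cs Pcs)

  β-AllCh : ∀ {P : ℕ → Set} cs → All P (labelsCh cs) → All (P ∘ β) cs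
  β-AllCh []       _   = []
  β-AllCh (c ∷ cs) Pcs = β-All c (++⁻ˡ (labels c) Pcs) ∷ β-AllCh cs (++⁻ʳ (labels c) Pcs)

mutual
  admissible : ∀ t → Unique (labels t) → All (1 ≤_) (labels t) → Admissible t
  admissible (node i cs) (i∉ ∷ u) (1≤i ∷ pos) = 1≤i , β-AllCh cs i∉ , admissibleCh cs u pos

  admissibleCh : ∀ cs → Unique (labelsCh cs) → All (1 ≤_) (labelsCh cs) → AdmissibleCh cs
  admissibleCh []       _ _   = tt
  admissibleCh (c ∷ cs) u pos with Unique-++⁻ (labels c) u
  ... | u-c , u-cs , disjoint =
    admissible c u-c (++⁻ˡ (labels c) pos) ,
    β-AllCh cs (β-All c disjoint) ,
    admissibleCh cs u-cs (++⁻ʳ (labels c) pos)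

-- The maps θ and ψ

merge : HTree → HTree → HTree
merge h (white j ds) = black (h ∷ white j ds ∷ [])
merge h (black ds)   = black (h ∷ ds)

-- An elder child joins the block of its right neighbour, a younger one opens a
-- new block; the clause for true and [] never fires, as the last child is younger.
attach : Bool → HTree → Forest → Forest
attach false h r       = h ∷ r
attach true  h []      = h ∷ []
attach true  h (x ∷ r) = merge h x ∷ r

mutual
  toWhite : PTree → HTree
  toWhite (node i cs) = white (pred i) (blocks cs)

  blocks : List PTree → Forest
  blocks []       = []
  blocks (c ∷ cs) = attach (elderB c cs) (toWhite c) (blocks cs)

θ : PTree → Forest
θ (node _ cs) = blocks cs

mutual
  flatten : HTree → List PTree
  flatten (white i cs) = flattenWhite i cs ∷ []
  flatten (black cs)   = flattenAll cs

  flattenAll : Forest → List PTree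
  flattenAll []       = []
  flattenAll (c ∷ cs) = flatten c ++ flattenAll cs

  flattenWhite : ℕ → Forest → PTree
  flattenWhite i cs = node (suc i) (flattenAll cs)

ψ : Forest → PTree
ψ F = node 1 (flattenAll F)

data Mergeable : HTree → Set where
  into-white : ∀ {j ds}  → Mergeable (white j ds)
  into-black : ∀ {d ds} → Mergeable (black (d ∷ ds))

data Attachable : Bool → Forest → Set where
  younger : ∀ {r}   → Attachable false r
  elder   : ∀ {x r} → Mergeable x → Attachable true (x ∷ r)

attach-attachable : ∀ b a ds r → Attachable true (attach b (white a ds) r)
attach-attachable false a ds r                = elder into-white
attach-attachable true  a ds []               = elder into-white
attach-attachable true  a ds (white j es ∷ r) = elder into-black
attach-attachable true  a ds (black es ∷ r)   = elder into-black

attachable : ∀ c cs → Attachable (elderB c cs) (blocks cs)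
attachable c []                     = younger
attachable c (node k es ∷ cs) with elderB c (node k es ∷ cs)
... | false = younger
... | true  = attach-attachable (elderB (node k es) cs) (pred k) (blocks es) (blocks cs)

flattenAll-++ : ∀ xs ys → flattenAll (xs ++ ys) ≡ flattenAll xs ++ flattenAll ys
flattenAll-++ []       ys = refl
flattenAll-++ (x ∷ xs) ys = trans (cong (flatten x ++_) (flattenAll-++ xs ys)) (sym (++-assoc (flatten x) _ _))

flattenAll-attach : ∀ b h r → flattenAll (attach b h r) ≡ flatten h ++ flattenAll r
flattenAll-attach false h r                = refl
flattenAll-attach true  h []               = refl
flattenAll-attach true  h (white j ds ∷ r) = ++-assoc (flatten h) (flatten (white j ds)) (flattenAll r)
flattenAll-attach true  h (black ds ∷ r)   = ++-assoc (flatten h) (flatten (black ds)) (flattenAll r)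

βH-merge : ∀ h {x} → Mergeable x → βH (merge h x) ≡ βH h ⊓ βH x
βH-merge h into-white             = refl
βH-merge h (into-black {d} {ds}) = βHFrom-⊓ (βH h) (βH d) ds

βHFrom-attach : ∀ {b r} m h → Attachable b r → βHFrom m (attach b h r) ≡ βHFrom (m ⊓ βH h) r
βHFrom-attach m h younger = refl
βHFrom-attach {r = x ∷ r} m h (elder mx) =
  cong (λ k → βHFrom k r) (trans (cong (m ⊓_) (βH-merge h mx)) (sym (⊓-assoc m (βH h) (βH x))))

mutual
  β-toWhite : ∀ t → Admissible t → suc (βH (toWhite t)) ≡ β t
  β-toWhite (node (suc i) cs) (_ , _ , adm) = βHFrom-blocks cs adm i

  βHFrom-blocks : ∀ cs → AdmissibleCh cs → ∀ m → suc (βHFrom m (blocks cs)) ≡ βFrom (suc m) cs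
  βHFrom-blocks []       _                   m = refl
  βHFrom-blocks (c ∷ cs) (adm-c , _ , adm) m = begin
    suc (βHFrom m (blocks (c ∷ cs)))              ≡⟨ cong suc (βHFrom-attach m (toWhite c) (attachable c cs)) ⟩
    suc (βHFrom (m ⊓ βH (toWhite c)) (blocks cs)) ≡⟨ βHFrom-blocks cs adm (m ⊓ βH (toWhite c)) ⟩
    βFrom (suc m ⊓ suc (βH (toWhite c))) cs       ≡⟨ cong (λ k → βFrom (suc m ⊓ k) cs) (β-toWhite c adm-c) ⟩
    βFrom (suc m ⊓ β c) cs                        ∎
    where open ≡-Reasoning

-- Statistics

length-attach : ∀ {b r} h → Attachable b r → length (attach b h r) ≡ ind (not b) + length r
length-attach h younger   = refl
length-attach h (elder _) = refl

young-blocks : ∀ cs → youngCh cs ≡ length (blocks cs)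
young-blocks []       = refl
young-blocks (c ∷ cs) =
  trans (cong (ind (not (elderB c cs)) +_) (young-blocks cs)) (sym (length-attach (toWhite c) (attachable c cs)))

bdegT-merge : ∀ h {x} → Mergeable x → bdegT (merge h x) ≡ suc (bdegT h + bdegT x)
bdegT-merge h (into-white {j} {ds}) = cong (λ k → suc (bdegT h + k)) (+-identityʳ (bdegT (white j ds)))
bdegT-merge h (into-black {d} {ds}) = cong suc (x∙yz≈y∙xz (length ds) (bdegT h) (bdegCh (d ∷ ds)))

bdegCh-attach : ∀ {b r} h → Attachable b r → bdegCh (attach b h r) ≡ ind b + bdegT h + bdegCh r
bdegCh-attach h younger = refl
bdegCh-attach {r = x ∷ r} h (elder mx) =
  trans (cong (_+ bdegCh r) (bdegT-merge h mx)) (cong suc (+-assoc (bdegT h) (bdegT x) (bdegCh r)))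

mutual
  eld-toWhite : ∀ t → eld t ≡ bdegT (toWhite t)
  eld-toWhite (node _ cs) = eld-blocks cs

  eld-blocks : ∀ cs → eldCh cs ≡ bdegCh (blocks cs)
  eld-blocks []       = refl
  eld-blocks (c ∷ cs) =
    trans (cong₂ (λ x y → ind (elderB c cs) + x + y) (eld-toWhite c) (eld-blocks cs))
          (sym (bdegCh-attach (toWhite c) (attachable c cs)))

impW-merge : ∀ j h {x} r → Mergeable x → impW j (merge h x ∷ r) ≡ impT nothing h + impW j (x ∷ r)
impW-merge j h r (into-white {a} {ds}) =
  trans (cong (λ k → impT nothing h + k + impW j r) (+-identityʳ (ind (βH (white a ds) <ᵇ j) + impW a ds)))
        (+-assoc (impT nothing h) _ (impW j r))
impW-merge j h r (into-black {d} {ds}) = +-assoc (impT nothing h) (impB (just j) (d ∷ ds)) (impW j r)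

impW-attach : ∀ {b r} j a ds → Attachable b r →
  impW j (attach b (white a ds) r) ≡ ind (not b ∧ (βH (white a ds) <ᵇ j)) + impW a ds + impW j r
impW-attach j a ds younger                = refl
impW-attach {r = x ∷ r} j a ds (elder mx) = impW-merge j (white a ds) r mx

impB-just-zero : ∀ ds → impB (just 0) ds ≡ impB nothing ds
impB-just-zero []            = refl
impB-just-zero (d ∷ [])      = refl
impB-just-zero (d ∷ d′ ∷ ds) = cong (impT nothing d +_) (impB-just-zero (d′ ∷ ds))

-- The root 1 becomes the white vertex 0, which lies below every label, so none
-- of its edges is improper.
impW-zero : ∀ F → impW 0 F ≡ impF F
impW-zero []               = refl
impW-zero (white j ds ∷ F) = cong (impW j ds +_) (impW-zero F)
impW-zero (black ds ∷ F)   = cong₂ _+_ (impB-just-zero ds) (impW-zero F)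

improper-edge : ∀ i c → Admissible c → suc i ≢ β c → not (suc i <ᵇ β c) ≡ (βH (toWhite c) <ᵇ i)
improper-edge i c adm i≢c = begin
  not (suc i <ᵇ β c)         ≡⟨ cong (λ b → not (suc i <ᵇ b)) (sym (β-toWhite c adm)) ⟩
  not (i <ᵇ βH (toWhite c)) ≡⟨ not-<ᵇ (λ i≡c → i≢c (trans (cong suc i≡c) (β-toWhite c adm))) ⟩
  (βH (toWhite c) <ᵇ i)     ∎
  where open ≡-Reasoning

mutual
  imp-toWhite : ∀ t → Admissible t → imp t ≡ impT nothing (toWhite t)
  imp-toWhite (node (suc i) cs) (_ , i≢cs , adm) = imp-blocks i cs i≢cs adm

  imp-blocks : ∀ i cs → All (λ c → suc i ≢ β c) cs → AdmissibleCh cs → impCh (suc i) cs ≡ impW i (blocks cs)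
  imp-blocks i []                    _              _                 = refl
  imp-blocks i (c@(node k es) ∷ cs) (i≢c ∷ i≢cs) (adm-c , _ , adm) = begin
    ind (not e ∧ not (suc i <ᵇ β c)) + imp c + impCh (suc i) cs
      ≡⟨ cong₂ _+_ (cong₂ _+_ (cong (λ b → ind (not e ∧ b)) (improper-edge i c adm-c i≢c))
                              (imp-toWhite c adm-c))
                   (imp-blocks i cs i≢cs adm) ⟩
    ind (not e ∧ (βH (toWhite c) <ᵇ i)) + impW (pred k) (blocks es) + impW i (blocks cs)
      ≡⟨ sym (impW-attach i (pred k) (blocks es) (attachable c cs)) ⟩
    impW i (blocks (c ∷ cs))
      ∎
    where
    open ≡-Reasoning
    e = elderB c cs

-- θ T is canonical

Canonical : Forest → Set
Canonical F = Linked _<_ (map βH F) × WFs F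

-- The invariant of blocks: its first block carries the least β of the siblings,
-- shifted down by one.
HeadedBy : ℕ → Forest → Set
HeadedBy b []      = ⊥
HeadedBy b (x ∷ _) = suc (βH x) ≡ b

WF-mergeable : ∀ x → WF x → Mergeable x
WF-mergeable (white j ds)     _        = into-white
WF-mergeable (black (d ∷ ds)) _        = into-black
WF-mergeable (black [])       (() , _)

lastIsMin-least : ∀ xs r → All (λ k → βH r < βH k) xs → βH r ≤ βH (black (xs ++ r ∷ []))
lastIsMin-least []       r _           = ≤-refl
lastIsMin-least (x ∷ xs) r (r<x ∷ r<xs) =
  βHFrom-glb (βH x) (xs ++ r ∷ []) (<⇒≤ r<x) (++⁺ (All.map <⇒≤ r<xs) (≤-refl ∷ []))

merge-WF : ∀ {a ds} x → WF (white a ds) → WF x → βH x < βH (white a ds) → WF (merge (white a ds) x)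
merge-WF (white j es) wf-h wf-x x<h =
  s≤s (s≤s z≤n) , tt ∷ tt ∷ [] , (_ ∷ [] , white j es , refl , x<h ∷ []) , wf-h , wf-x , tt
merge-WF {a} {ds} (black (d ∷ es)) wf-h (_ , whites , (xs , r , eq , r<xs) , wfs) x<h =
  s≤s (s≤s z≤n) , tt ∷ whites , (white a ds ∷ xs , r , cong (white a ds ∷_) eq , r<h ∷ r<xs) , wf-h , wfs
  where
  r<h : βH r < βH (white a ds)
  r<h = ≤-<-trans (subst (λ es′ → βH r ≤ βH (black es′)) (sym eq) (lastIsMin-least xs r r<xs)) x<h

younger-canonical : ∀ c c′ cs {x r} → Admissible c → WF (toWhite c) →
  Canonical (x ∷ r) → suc (βH x) ≡ βFrom (β c′) cs → β c < βFrom (β c′) cs →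
  Canonical (toWhite c ∷ x ∷ r) × HeadedBy (βFrom (β c) (c′ ∷ cs)) (toWhite c ∷ x ∷ r)
younger-canonical c c′ cs {x} adm-c wf-c (lk , wfs) x-head c<μ = (h<x ∷ lk , wf-c , wfs) , h-head
  where
  open ≡-Reasoning
  h<x : βH (toWhite c) < βH x
  h<x = s<s⁻¹ (subst₂ _<_ (sym (β-toWhite c adm-c)) (sym x-head) c<μ)
  h-head : suc (βH (toWhite c)) ≡ βFrom (β c) (c′ ∷ cs)
  h-head = begin
    suc (βH (toWhite c))  ≡⟨ β-toWhite c adm-c ⟩
    β c                   ≡⟨ sym (m≤n⇒m⊓n≡m (<⇒≤ c<μ)) ⟩
    β c ⊓ βFrom (β c′) cs ≡⟨ sym (βFrom-⊓ (β c) (β c′) cs) ⟩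
    βFrom (β c) (c′ ∷ cs) ∎

elder-canonical : ∀ k es c′ cs {x r} → let c = node k es in Admissible c → WF (toWhite c) →
  Canonical (x ∷ r) → suc (βH x) ≡ βFrom (β c′) cs → βFrom (β c′) cs < β c →
  Canonical (merge (toWhite c) x ∷ r) × HeadedBy (βFrom (β c) (c′ ∷ cs)) (merge (toWhite c) x ∷ r)
elder-canonical k es c′ cs {x} {r} adm-c wf-c (lk , wf-x , wfs) x-head μ<c =
  (subst (λ b → Linked _<_ (b ∷ map βH r)) (sym y≡x) lk , merge-WF x wf-c wf-x x<h , wfs) , y-head
  where
  open ≡-Reasoning
  c = node k es
  x<h : βH x < βH (toWhite c)
  x<h = s<s⁻¹ (subst₂ _<_ (sym x-head) (sym (β-toWhite c adm-c)) μ<c)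
  y≡x : βH (merge (toWhite c) x) ≡ βH x
  y≡x = trans (βH-merge (toWhite c) (WF-mergeable x wf-x)) (m≥n⇒m⊓n≡n (<⇒≤ x<h))
  y-head : suc (βH (merge (toWhite c) x)) ≡ βFrom (β c) (c′ ∷ cs)
  y-head = begin
    suc (βH (merge (toWhite c) x)) ≡⟨ cong suc y≡x ⟩
    suc (βH x)                     ≡⟨ x-head ⟩
    βFrom (β c′) cs                ≡⟨ sym (m≥n⇒m⊓n≡n (<⇒≤ μ<c)) ⟩
    β c ⊓ βFrom (β c′) cs          ≡⟨ sym (βFrom-⊓ (β c) (β c′) cs) ⟩
    βFrom (β c) (c′ ∷ cs)          ∎

attach-canonical : ∀ c c′ cs {r} → Admissible c → WF (toWhite c) → All (λ q → β c ≢ β q) (c′ ∷ cs) →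
  Canonical r × HeadedBy (βFrom (β c′) cs) r →
  let F = attach (elderB c (c′ ∷ cs)) (toWhite c) r in Canonical F × HeadedBy (βFrom (β c) (c′ ∷ cs)) F
attach-canonical c c′ cs {[]} _ _ _ (_ , ())
attach-canonical c@(node k es) c′ cs {x ∷ r} adm-c wf-c c≢cs (canonical , x-head)
  with elderB c (c′ ∷ cs) | elderView c (c′ ∷ cs)
... | false | younger c≤cs = younger-canonical c c′ cs adm-c wf-c canonical x-head c<μ
  where
  c<μ : β c < βFrom (β c′) cs
  c<μ with All.zipWith (λ (c≤q , c≢q) → ≤∧≢⇒< c≤q c≢q) (c≤cs , c≢cs)
  ... | c<c′ ∷ c<cs = βFrom-glb (β c′) cs c<c′ c<cs
... | true | elder cs<c = elder-canonical k es c′ cs adm-c wf-c canonical x-head (least<c cs<c)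
  where
  least<c : Any (λ q → β q < β c) (c′ ∷ cs) → βFrom (β c′) cs < β c
  least<c (here c′<c)  = ≤-<-trans (βFrom-≤ (β c′) cs) c′<c
  least<c (there cs<c) = βFrom-< (β c′) cs cs<c

mutual
  toWhite-WF : ∀ t → Admissible t → WF (toWhite t)
  toWhite-WF (node i cs) (_ , _ , adm) = blocks-canonical cs adm

  blocks-canonical : ∀ cs → AdmissibleCh cs → Canonical (blocks cs)
  blocks-canonical []       _   = [] , tt
  blocks-canonical (c ∷ cs) adm = proj₁ (blocks-headed c cs adm)

  blocks-headed : ∀ c cs → AdmissibleCh (c ∷ cs) →
                  Canonical (blocks (c ∷ cs)) × HeadedBy (βFrom (β c) cs) (blocks (c ∷ cs))
  blocks-headed c []         (adm-c , _ , _)       = ([-] , toWhite-WF c adm-c , tt) , β-toWhite c adm-c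
  blocks-headed c (c′ ∷ cs) (adm-c , c≢cs , adm) =
    attach-canonical c c′ cs adm-c (toWhite-WF c adm-c) c≢cs (blocks-headed c′ cs adm)

-- ψ inverts θ

mutual
  flatten-toWhite : ∀ t → Admissible t → flatten (toWhite t) ≡ t ∷ []
  flatten-toWhite (node (suc i) cs) (_ , _ , adm) = cong (λ cs′ → node (suc i) cs′ ∷ []) (flattenAll-blocks cs adm)

  flattenAll-blocks : ∀ cs → AdmissibleCh cs → flattenAll (blocks cs) ≡ cs
  flattenAll-blocks []       _                   = refl
  flattenAll-blocks (c ∷ cs) (adm-c , _ , adm) =
    trans (flattenAll-attach (elderB c cs) (toWhite c) (blocks cs))
          (cong₂ _++_ (flatten-toWhite c adm-c) (flattenAll-blocks cs adm))

mutual
  β-flatten : ∀ x → WF x → ∀ m → βFrom (suc m) (flatten x) ≡ suc (m ⊓ βH x)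
  β-flatten (white a es)     (_ , wfs)         m = cong (suc m ⊓_) (β-flattenAll es wfs a)
  β-flatten (black (e ∷ es)) (_ , _ , _ , wfs) m =
    trans (β-flattenAll (e ∷ es) wfs m) (cong suc (βHFrom-⊓ m (βH e) es))

  β-flattenAll : ∀ F → WFs F → ∀ m → βFrom (suc m) (flattenAll F) ≡ suc (βHFrom m F)
  β-flattenAll []      _           m = refl
  β-flattenAll (x ∷ F) (wf-x , wfs) m = begin
    βFrom (suc m) (flatten x ++ flattenAll F)         ≡⟨ βFrom-++ (suc m) (flatten x) (flattenAll F) ⟩
    βFrom (βFrom (suc m) (flatten x)) (flattenAll F) ≡⟨ cong (λ k → βFrom k (flattenAll F)) (β-flatten x wf-x m) ⟩
    βFrom (suc (m ⊓ βH x)) (flattenAll F)            ≡⟨ β-flattenAll F wfs (m ⊓ βH x) ⟩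
    suc (βHFrom (m ⊓ βH x) F)                        ∎
    where open ≡-Reasoning

mutual
  flatten-lower : ∀ x → WF x → ∀ {k} → k ≤ βH x → All (λ u → k < β u) (flatten x)
  flatten-lower (white a es) (_ , wfs) {k} k≤x = subst (k <_) (sym (β-flattenAll es wfs a)) (s≤s k≤x) ∷ []
  flatten-lower (black (e ∷ es)) (_ , _ , _ , wfs) k≤x =
    flattenAll-lower (e ∷ es) wfs (All.map (≤-trans k≤x) (βHFrom-≤ (βH e) es ∷ βHFrom-≤-each (βH e) es))

  flattenAll-lower : ∀ F → WFs F → ∀ {k} → All (λ d → k ≤ βH d) F → All (λ u → k < β u) (flattenAll F)
  flattenAll-lower []      _            []            = []
  flattenAll-lower (x ∷ F) (wf-x , wfs) (k≤x ∷ k≤F) =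
    ++⁺ (flatten-lower x wf-x k≤x) (flattenAll-lower F wfs k≤F)

RoundTrip : HTree → Set
RoundTrip (white a es) = toWhite (flattenWhite a es) ≡ white a es × β (flattenWhite a es) ≡ suc (βH (white a es))
RoundTrip (black _)    = ⊥

prependBlock : List HTree → HTree → Forest → Forest
prependBlock []       r F = r ∷ F
prependBlock (z ∷ zs) r F = black (z ∷ zs ++ r ∷ []) ∷ F

attach-prependBlock : ∀ z zs a es F →
  attach true z (prependBlock zs (white a es) F) ≡ prependBlock (z ∷ zs) (white a es) F
attach-prependBlock z []      a es F = refl
attach-prependBlock z (_ ∷ _) a es F = refl

blocks-elders : ∀ zs {a es ys F} → All RoundTrip zs → RoundTrip (white a es) →
  All (λ z → βH (white a es) < βH z) zs → All (λ u → suc (βH (white a es)) < β u) ys → blocks ys ≡ F →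
  blocks (flattenAll zs ++ flattenWhite a es ∷ ys) ≡ prependBlock zs (white a es) F
blocks-elders [] {a} {es} {ys} [] (rt-r , β-r) _ r<ys refl = begin
  attach (elderB t-r ys) (toWhite t-r) (blocks ys)
    ≡⟨ cong (λ b → attach b (toWhite t-r) (blocks ys)) (elderB-false t-r ys r≤ys) ⟩
  toWhite t-r ∷ blocks ys
    ≡⟨ cong (_∷ blocks ys) rt-r ⟩
  white a es ∷ blocks ys
    ∎
  where
  open ≡-Reasoning
  t-r = flattenWhite a es
  r≤ys : All (λ u → β t-r ≤ β u) ys
  r≤ys = subst (λ b → All (λ u → b ≤ β u) ys) (sym β-r) (All.map <⇒≤ r<ys)
blocks-elders (white b fs ∷ zs) {a} {es} {ys} {F} ((rt-z , β-z) ∷ rts) rt-r@(_ , β-r) (r<z ∷ r<zs) r<ys ys≡F =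
  begin
  attach (elderB t-z rest) (toWhite t-z) (blocks rest)
    ≡⟨ cong (λ e → attach e (toWhite t-z) (blocks rest)) (elderB-true t-z rest r-in-rest) ⟩
  attach true (toWhite t-z) (blocks rest)
    ≡⟨ cong₂ (attach true) rt-z (blocks-elders zs rts rt-r r<zs r<ys ys≡F) ⟩
  attach true (white b fs) (prependBlock zs (white a es) F)
    ≡⟨ attach-prependBlock (white b fs) zs a es F ⟩
  prependBlock (white b fs ∷ zs) (white a es) F
    ∎
  where
  open ≡-Reasoning
  t-z = flattenWhite b fs
  t-r = flattenWhite a es
  rest = flattenAll zs ++ t-r ∷ ys
  r-in-rest : Any (λ u → β u < β t-z) rest
  r-in-rest = Any.++⁺ʳ (flattenAll zs) (here (subst₂ _<_ (sym β-r) (sym β-z) (s≤s r<z)))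
blocks-elders (black _ ∷ _) (() ∷ _) _ _ _ _

blocks-black : ∀ ds F → WF (black ds) → All RoundTrip ds → WFs F → All (λ d → βH (black ds) < βH d) F →
  blocks (flattenAll F) ≡ F → blocks (flattenAll ds ++ flattenAll F) ≡ black ds ∷ F
blocks-black _ F (s≤s () , _ , ([] , r , refl , _) , _)
blocks-black _ F (_ , _ , (z ∷ zs , black _ , refl , _) , _) rts = ⊥-elim (All.head (++⁻ʳ (z ∷ zs) rts))
blocks-black _ F (_ , _ , (z ∷ zs , white a es , refl , r<zs) , _) rts wfs ds<F blocks-F = begin
  blocks (flattenAll (z ∷ zs ++ white a es ∷ []) ++ flattenAll F)
    ≡⟨ cong blocks split ⟩
  blocks (flattenAll (z ∷ zs) ++ flattenWhite a es ∷ flattenAll F)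
    ≡⟨ blocks-elders (z ∷ zs) (++⁻ˡ (z ∷ zs) rts) (All.head (++⁻ʳ (z ∷ zs) rts)) r<zs r<F blocks-F ⟩
  prependBlock (z ∷ zs) (white a es) F
    ∎
  where
  open ≡-Reasoning
  split : flattenAll ((z ∷ zs) ++ white a es ∷ []) ++ flattenAll F ≡
          flattenAll (z ∷ zs) ++ flattenWhite a es ∷ flattenAll F
  split = trans (cong (_++ flattenAll F) (flattenAll-++ (z ∷ zs) (white a es ∷ [])))
                (++-assoc (flattenAll (z ∷ zs)) _ (flattenAll F))
  r<F : All (λ u → suc (βH (white a es)) < β u) (flattenAll F)
  r<F = flattenAll-lower F wfs (All.map (≤-<-trans (lastIsMin-least (z ∷ zs) (white a es) r<zs)) ds<F)

mutual
  roundTrip : ∀ a es → WF (white a es) → RoundTrip (white a es)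
  roundTrip a es (lk , wfs) = cong (white a) (blocks-flattenAll es (lk , wfs)) , β-flattenAll es wfs a

  roundTrips : ∀ ds → All IsWhite ds → WFs ds → All RoundTrip ds
  roundTrips []                _            _          = []
  roundTrips (white a es ∷ ds) (_ ∷ whites) (wf , wfs) = roundTrip a es wf ∷ roundTrips ds whites wfs

  blocks-flattenAll : ∀ F → Canonical F → blocks (flattenAll F) ≡ F
  blocks-flattenAll []               _                = refl
  blocks-flattenAll (white a es ∷ F) (lk , wf , wfs) with roundTrip a es wf
  ... | toWhite-t , β-t = begin
    attach (elderB t (flattenAll F)) (toWhite t) (blocks (flattenAll F))
      ≡⟨ cong (λ b → attach b (toWhite t) (blocks (flattenAll F))) (elderB-false t (flattenAll F) t≤F) ⟩
    toWhite t ∷ blocks (flattenAll F)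
      ≡⟨ cong₂ _∷_ toWhite-t (blocks-flattenAll F (Linked.tail lk , wfs)) ⟩
    white a es ∷ F
      ∎
    where
    open ≡-Reasoning
    t = flattenWhite a es
    t≤F : All (λ u → β t ≤ β u) (flattenAll F)
    t≤F = subst (λ b → All (λ u → b ≤ β u) (flattenAll F)) (sym β-t)
                (All.map <⇒≤ (flattenAll-lower F wfs (All.map⁻ (Linked-head lk))))
  blocks-flattenAll (black ds ∷ F) (lk , wf@(_ , whites , _ , wfs-ds) , wfs) =
    blocks-black ds F wf (roundTrips ds whites wfs-ds) wfs (All.map⁻ (Linked-head lk))
                 (blocks-flattenAll F (Linked.tail lk , wfs))

labelsCh-++ : ∀ xs ys → labelsCh (xs ++ ys) ≡ labelsCh xs ++ labelsCh ys
labelsCh-++ []       ys = refl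
labelsCh-++ (x ∷ xs) ys = trans (cong (labels x ++_) (labelsCh-++ xs ys)) (sym (++-assoc (labels x) _ _))

mutual
  labelsCh-flatten : ∀ x → labelsCh (flatten x) ≡ map suc (whiteLabels x)
  labelsCh-flatten (white i cs) = cong (suc i ∷_) (trans (++-identityʳ _) (labelsCh-flattenAll cs))
  labelsCh-flatten (black cs)   = labelsCh-flattenAll cs

  labelsCh-flattenAll : ∀ F → labelsCh (flattenAll F) ≡ map suc (whiteLabelsCh F)
  labelsCh-flattenAll []      = refl
  labelsCh-flattenAll (x ∷ F) = begin
    labelsCh (flatten x ++ flattenAll F)                  ≡⟨ labelsCh-++ (flatten x) (flattenAll F) ⟩
    labelsCh (flatten x) ++ labelsCh (flattenAll F)       ≡⟨ cong₂ _++_ (labelsCh-flatten x) (labelsCh-flattenAll F) ⟩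
    map suc (whiteLabels x) ++ map suc (whiteLabelsCh F) ≡⟨ sym (map-++ suc (whiteLabels x) (whiteLabelsCh F)) ⟩
    map suc (whiteLabelsCh (x ∷ F))                       ∎
    where open ≡-Reasoning

range1-suc : ∀ n → range1 (suc n) ≡ 1 ∷ map suc (range1 n)
range1-suc n = cong (λ xs → 1 ∷ map suc xs) (sym (map-upTo suc n))

map-pred-suc : ∀ xs → map pred (map suc xs) ≡ xs
map-pred-suc xs = trans (sym (map-∘ xs)) (map-id xs)

ψ-labels↭ : ∀ n F → (labels (ψ F) ↭ range1 (suc n)) ⇔ (whiteLabelsCh F ↭ range1 n)
ψ-labels↭ n F = mk⇔ to from
  where
  labels-ψ : labels (ψ F) ≡ 1 ∷ map suc (whiteLabelsCh F)
  labels-ψ = cong (1 ∷_) (labelsCh-flattenAll F)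
  to : labels (ψ F) ↭ range1 (suc n) → whiteLabelsCh F ↭ range1 n
  to p = subst₂ _↭_ (map-pred-suc _) (map-pred-suc _)
                (↭-map⁺ pred (drop-∷ (subst₂ _↭_ labels-ψ (range1-suc n) p)))
  from : whiteLabelsCh F ↭ range1 n → labels (ψ F) ↭ range1 (suc n)
  from q = subst₂ _↭_ (sym labels-ψ) (sym (range1-suc n)) (↭-prep 1 (↭-map⁺ suc q))

IsO⇒Admissible : ∀ n T → IsO n T → Admissible T
IsO⇒Admissible n T (_ , p) =
  admissible T (Unique-resp-↭ (↭⇒↭ₛ (↭-sym p)) range-unique) (All-resp-↭ (↭-sym p) range-positive)
  where
  range-unique : Unique (range1 (suc n))
  range-unique = Unique.map⁺ suc-injective (Unique.upTo⁺ (suc n))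
  range-positive : All (1 ≤_) (range1 (suc n))
  range-positive = All.map⁺ (All.universal (λ _ → s≤s z≤n) (upTo (suc n)))

ψ-θ : ∀ n T → IsO n T → ψ (θ T) ≡ T
ψ-θ n T@(node _ cs) o@(refl , _) with IsO⇒Admissible n T o
... | _ , _ , adm = cong (node 1) (flattenAll-blocks cs adm)

θ-IsH : ∀ n T → IsO n T → IsH n (θ T)
θ-IsH n T@(node _ cs) o@(refl , p) with IsO⇒Admissible n T o
... | _ , _ , adm =
  let lk , wfs = blocks-canonical cs adm
  in lk , wfs , Equivalence.to (ψ-labels↭ n (θ T))
                               (subst (λ T′ → labels T′ ↭ range1 (suc n)) (sym (ψ-θ n T o)) p)

ψ-IsO : ∀ n F → IsH n F → IsO n (ψ F)
ψ-IsO n F (_ , _ , p) = refl , Equivalence.from (ψ-labels↭ n F) p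

θ-statistics : ∀ n T → IsO n T →
  (youngRoot T ≡ treeF (θ T)) × (eld T ≡ bdegCh (θ T)) × (imp T ≡ impF (θ T))
θ-statistics n T@(node _ cs) o@(refl , _) =
  young-blocks cs , eld-blocks cs , trans (imp-toWhite T (IsO⇒Admissible n T o)) (impW-zero (θ T))

proposition3p3 : (n : ℕ) → 1 ≤ n →
    Σ (PTree → Forest) λ θ →
      (∀ T → IsO n T → IsH n (θ T)) ×
      (∀ T T′ → IsO n T → IsO n T′ → θ T ≡ θ T′ → T ≡ T′) ×
      (∀ F → IsH n F → ∃ λ T → IsO n T × θ T ≡ F) ×
      (∀ T → IsO n T →
        (youngRoot T ≡ treeF (θ T)) × (eld T ≡ bdegCh (θ T)) × (imp T ≡ impF (θ T)))
proposition3p3 n _ = θ , θ-IsH n , θ-injective , θ-surjective , θ-statistics n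
  where
  θ-injective : ∀ T T′ → IsO n T → IsO n T′ → θ T ≡ θ T′ → T ≡ T′
  θ-injective T T′ o o′ θT≡θT′ = trans (sym (ψ-θ n T o)) (trans (cong ψ θT≡θT′) (ψ-θ n T′ o′))
  θ-surjective : ∀ F → IsH n F → ∃ λ T → IsO n T × θ T ≡ F
  θ-surjective F h@(lk , wfs , _) = ψ F , ψ-IsO n F h , blocks-flattenAll F (lk , wfs)
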